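{- Let $G$ be a prereduced graph, $W$ an induced subgraph of $G$ that is a $\dagger$-AW $(s:c:l,B,r)$ or a $\ddagger$-AW $(s:c_1,c_2:l,B,r)$, and let $x$ be a vertex adjacent to $s$. (1) $x$ is adjacent to every center of $W$ different from $x$. (2) (full) If $x$ is adjacent to every vertex of $B$, then $x$ is adjacent to every vertex of $N(s)\setminus\{x\}$. (partial) If $x$ is adjacent to some but not all vertices of $B$, then $G$ contains an induced $\dagger$- or $\ddagger$-AW whose shallow terminal is $s$, one of whose centers is $x$, and whose base is the vertex set of a proper subpath of the path $b_1b_2\cdots b_d$. (none) If $x$ is adjacent to no vertex of $B$, then $x$ is adjacent to neither $l$ nor $r$, and the graph obtained from $W$ by replacing $s$ with $x$, namely $(x:c:l,B,r)$ resp. $(x:c_1,c_2:l,B,r)$, is an induced $\dagger$- resp. $\ddagger$-AW in $G$.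
   Context: Graphs are finite, simple, undirected. A minimal forbidden set is $X\subseteq V(G)$ with $G[X]$ not an interval graph but every proper subset inducing an interval graph; $G$ is prereduced if it has no minimal forbidden set of at most $10$ vertices. A $\dagger$-AW $(s:c:l,B,r)$, $B=\{b_1,\dots,b_d\}$, $d\ge 3$, $b_0=l$, $b_{d+1}=r$: vertices $s,c,b_0,\dots,b_{d+1}$ with edges exactly $b_ib_{i+1}$ $(0\le i\le d)$, $cs$, $cb_i$ $(1\le i\le d)$. A $\ddagger$-AW $(s:c_1,c_2:l,B,r)$, $d\ge 2$: vertices $s,c_1,c_2,b_0,\dots,b_{d+1}$ with edges exactly $b_ib_{i+1}$, $c_1c_2$, $c_1s$, $c_2s$, $c_1l$, $c_2r$, $c_jb_i$ ($j=1,2$, $1\le i\le d$). In these, $s$ is the shallow terminal, $l,r$ the base terminals, the neighbors of $s$ ($c$, resp. $c_1,c_2$) the centers, and $B$ the base (ordered as the path $b_1\cdots b_d$). -}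

module Defs where

open import Data.Nat using (ℕ; zero; suc; _≤_; _<_; _≡ᵇ_; _≤ᵇ_)
open import Data.Bool using (Bool; true; false; not; _∧_; _∨_)
open import Data.Fin using (Fin; toℕ; fromℕ)
open import Data.Fin.Subset using (Subset; _∈_; _⊂_; ∣_∣)
open import Data.Product using (Σ; _×_; _,_)
open import Relation.Binary.PropositionalEquality using (_≡_; _≢_)
open import Relation.Nullary using (¬_)
open import Function.Bundles using (_⇔_)
open import Function.Definitions using (Injective)

record Graph : Set where
  field
    n      : ℕ
    adj    : Fin n → Fin n → Bool
    irrefl : ∀ v → adj v v ≡ false
    sym    : ∀ u v → adj u v ≡ adj v u

open Graph public

Adj : (G : Graph) → Fin (n G) → Fin (n G) → Set
Adj G u v = adj G u v ≡ true

-- G[X] is an interval graph iff there are closed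
-- intervals [lo v , hi v] (v ∈ X) such that distinct u, v ∈ X are adjacent
-- iff their intervals intersect.  (Integer endpoints; for finite graphs
-- this is the same class as with real endpoints.)

IntervalOn : (G : Graph) → Subset (n G) → Set
IntervalOn G X =
  Σ (Fin (n G) → ℕ) λ lo → Σ (Fin (n G) → ℕ) λ hi →
    (∀ v → v ∈ X → lo v ≤ hi v) ×
    (∀ u v → u ∈ X → v ∈ X → u ≢ v →
       (Adj G u v ⇔ (lo u ≤ hi v × lo v ≤ hi u)))

MinimalForbidden : (G : Graph) → Subset (n G) → Set
MinimalForbidden G X =
  ¬ IntervalOn G X × (∀ Y → Y ⊂ X → IntervalOn G Y)

Prereduced : Graph → Set
Prereduced G = ∀ X → MinimalForbidden G X → ¬ (∣ X ∣ ≤ 10)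

-- Asteroidal witnesses (†-AW and ‡-AW) as labelled pattern graphs.
-- Base-path vertices are bV i, i : Fin (d + 2), with bV 0 = l,
-- bV (d+1) = r and bV i = b_i for 1 ≤ i ≤ d.

data Kind : Set where
  dagger ddagger : Kind

data Lab : Kind → ℕ → Set where
  sV  : ∀ {k d} → Lab k d
  cV  : ∀ {d} → Lab dagger d
  c1V : ∀ {d} → Lab ddagger d
  c2V : ∀ {d} → Lab ddagger d
  bV  : ∀ {k d} → Fin (suc (suc d)) → Lab k d

minBase : Kind → ℕ
minBase dagger  = 3
minBase ddagger = 2

pathAdj : ∀ {m} → Fin m → Fin m → Bool
pathAdj i j = (suc (toℕ i) ≡ᵇ toℕ j) ∨ (suc (toℕ j) ≡ᵇ toℕ i)

innerB : ∀ {d} → Fin (suc (suc d)) → Bool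
innerB {d} i = not (toℕ i ≡ᵇ 0) ∧ not (toℕ i ≡ᵇ suc d)

pat : ∀ {k d} → Lab k d → Lab k d → Bool
pat sV cV = true
pat cV sV = true
pat cV (bV i) = innerB i
pat (bV i) cV = innerB i
pat sV c1V = true
pat sV c2V = true
pat c1V sV = true
pat c2V sV = true
pat c1V c2V = true
pat c2V c1V = true
pat {d = d} c1V (bV i) = toℕ i ≤ᵇ d
pat {d = d} (bV i) c1V = toℕ i ≤ᵇ d
pat c2V (bV i) = not (toℕ i ≡ᵇ 0)
pat (bV i) c2V = not (toℕ i ≡ᵇ 0)
pat (bV i) (bV j) = pathAdj i j
pat _ _ = false

isCenter : ∀ {k d} → Lab k d → Bool
isCenter cV  = true
isCenter c1V = true
isCenter c2V = true
isCenter _   = false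

IsAW : (G : Graph) (k : Kind) (d : ℕ) → (Lab k d → Fin (n G)) → Set
IsAW G k d f =
  minBase k ≤ d × Injective _≡_ _≡_ f × (∀ u v → adj G (f u) (f v) ≡ pat u v)

record AW (G : Graph) : Set where
  field
    kind : Kind
    d    : ℕ
    emb  : Lab kind d → Fin (n G)
    isAW : IsAW G kind d emb

open AW public

shallow : ∀ {G} → AW G → Fin (n G)
shallow W = emb W sV

lTerm rTerm : ∀ {G} → AW G → Fin (n G)
lTerm W = emb W (bV Data.Fin.zero)
rTerm W = emb W (bV (fromℕ (suc (d W))))

bAt : ∀ {G} (W : AW G) → Fin (suc (suc (d W))) → Fin (n G)
bAt W i = emb W (bV i)

Inner : ∀ {G} (W : AW G) → Fin (suc (suc (d W))) → Set
Inner W i = 1 ≤ toℕ i × toℕ i ≤ d W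

IsCenterOf : ∀ {G} → AW G → Fin (n G) → Set
IsCenterOf W v = Σ (Lab (kind W) (d W)) λ a → isCenter a ≡ true × emb W a ≡ v

InBase : ∀ {G} → AW G → Fin (n G) → Set
InBase W v = Σ (Fin (suc (suc (d W)))) λ i → Inner W i × bAt W i ≡ v

replaceS : ∀ {G} (W : AW G) → Fin (n G) → Lab (kind W) (d W) → Fin (n G)
replaceS W x sV = x
replaceS W x a  = emb W a

-- In a prereduced graph every set of at most ten vertices induces an interval graph, so each part
-- is proved by exhibiting an induced C₄ or C₅ or a small asteroidal triple.
-- (1) and (2, full) are one fact: a neighbour x of s is adjacent to every other neighbour z of s
-- that sees all of B; otherwise x misses the whole base path and {x, l, r} is an asteroidal
-- triple, l and r being joined through z.
-- (2, partial): take the maximal run of base vertices adjacent to x around one of its neighbours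
-- in B. A run with one or two vertices of B leaves an asteroidal triple {s, b i, b j} with
-- j - i ≤ 4; a longer run is the base of a †-AW with center x, or, if it reaches l or r, of a
-- ‡-AW whose centers are x and a center of W.
-- (2, none): x then has exactly the neighbours of s in W.
module Submission where

open import Defs
open import Data.Bool using (true; false; not; T) renaming (_≟_ to _≟ᵇ_)
open import Data.Bool.Properties using (T-≡; T-not-≡; T-∧; T-∨; ¬-not)
open import Data.Empty using (⊥; ⊥-elim)
open import Data.Fin using (Fin; zero; suc; toℕ; fromℕ<; #_)
open import Data.Fin.Properties using (toℕ-injective; toℕ-fromℕ; toℕ-fromℕ<; toℕ<n)
open import Data.Fin.Subset using (Subset; _∈_; _⊂_; ∣_∣; ⁅_⁆; _∪_; inside; outside)
  renaming (⊥ to ∅)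
open import Data.Fin.Subset.Properties
  using (_⊂?_; p⊂q⇒∣p∣<∣q∣; x∈⁅x⁆; x∈p∪q⁺; ∣⊥∣≡0; ∪-identityˡ; ∣p∣≤∣x∷p∣)
open import Data.List using (List; []; _∷_; length; lookup; applyUpTo)
open import Data.List.Relation.Unary.All using (All; []; _∷_) renaming (map to All-map)
open import Data.List.Relation.Unary.Any using (here; there)
open import Data.List.Membership.Propositional using () renaming (_∈_ to _∈ₗ_)
open import Data.List.Membership.Propositional.Properties using (∈-lookup; ∈-applyUpTo⁺)
open import Data.List.Properties using (length-applyUpTo)
open import Data.Nat using (ℕ; zero; suc; _+_; _∸_; _≤_; _<_; z≤n; s≤s; _≤?_; _≡ᵇ_; _≤ᵇ_)
open import Data.Nat.Induction using (<-wellFounded)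
open import Data.Nat.Properties
open import Data.Product using (Σ; _×_; _,_; proj₁; proj₂)
open import Data.Sum using (_⊎_; inj₁; inj₂; [_,_]′)
open import Data.Sum.Function.Propositional using (_⊎-⇔_)
open import Data.Vec using ([]; _∷_)
open import Function.Properties.Equivalence using () renaming (trans to ⇔-trans; sym to ⇔-sym)
open import Function using (const)
open import Function.Bundles using (_⇔_; mk⇔; Equivalence)
open import Induction.WellFounded using (Acc; acc)
open import Relation.Binary.PropositionalEquality
  using (_≡_; _≢_; refl; cong; cong₂; subst; subst₂; ≢-sym; module ≡-Reasoning)
  renaming (sym to ≡-sym; trans to ≡-trans)
open import Relation.Nullary using (¬_; Dec; yes; no; contradiction)
open import Relation.Binary.Definitions using (tri<; tri≈; tri>)
open import Relation.Nullary.Negation using (¬¬-map)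

module Basics (G : Graph) where

  private
    V : Set
    V = Fin (n G)

  Adj-sym : ∀ {u v} → Adj G u v → Adj G v u
  Adj-sym {u} {v} u~v = ≡-trans (sym G v u) u~v

  ¬Adj-sym : ∀ {u v} → ¬ Adj G u v → ¬ Adj G v u
  ¬Adj-sym u≁v v~u = u≁v (Adj-sym v~u)

  Adj⇒≢ : ∀ {u v} → Adj G u v → u ≢ v
  Adj⇒≢ {u} u~u refl with ≡-trans (≡-sym u~u) (irrefl G u)
  ... | ()

  ≢-by : ∀ {u v w} → Adj G u w → ¬ Adj G v w → u ≢ v
  ≢-by u~w v≁w refl = v≁w u~w

  Adj? : ∀ u v → Dec (Adj G u v)
  Adj? u v = adj G u v ≟ᵇ true

  Adj⇔T⇒adj≡ : ∀ {u v p} → Adj G u v ⇔ T p → adj G u v ≡ p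
  Adj⇔T⇒adj≡ {p = false} u~v⇔⊥ = ¬-not (Equivalence.to u~v⇔⊥)
  Adj⇔T⇒adj≡ {p = true}  u~v⇔⊤ = Equivalence.from u~v⇔⊤ _

  ¬Adj⇒adj≡false : ∀ {u v} → ¬ Adj G u v → adj G u v ≡ false
  ¬Adj⇒adj≡false u≁v = Adj⇔T⇒adj≡ (mk⇔ u≁v λ ())

  data Walk (P : V → Set) : V → V → Set where
    [_]    : ∀ {a} → P a → Walk P a a
    _∷⟨_⟩_ : ∀ {a b c} → P a → Adj G a b → Walk P b c → Walk P a c

  infixr 5 _∷⟨_⟩_

  module _ {P : V → Set} where

    first : ∀ {a c} → Walk P a c → P a
    first [ pa ]         = pa
    first (pa ∷⟨ _ ⟩ _) = pa

    last : ∀ {a c} → Walk P a c → P c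
    last [ pc ]        = pc
    last (_ ∷⟨ _ ⟩ w) = last w

    reverse : ∀ {a c} → Walk P a c → Walk P c a
    reverse w = onto w [ first w ]
      where
      onto : ∀ {a c e} → Walk P a c → Walk P a e → Walk P c e
      onto [ _ ]               w′ = w′
      onto (_ ∷⟨ a~b ⟩ rest) w′ = onto rest (first rest ∷⟨ Adj-sym a~b ⟩ w′)

-- Small vertex sets of a prereduced graph

-- Opaque, so that vs can be recovered from fromList vs by unification.
opaque
  fromList : ∀ {m} → List (Fin m) → Subset m
  fromList []       = ∅
  fromList (v ∷ vs) = ⁅ v ⁆ ∪ fromList vs

  ∈-fromList : ∀ {m} {v : Fin m} {vs} → v ∈ₗ vs → v ∈ fromList vs
  ∈-fromList (here refl) = x∈p∪q⁺ (inj₁ (x∈⁅x⁆ _))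
  ∈-fromList (there v∈)  = x∈p∪q⁺ (inj₂ (∈-fromList v∈))

  ∣fromList∣≤length : ∀ {m} (vs : List (Fin m)) → ∣ fromList vs ∣ ≤ length vs
  ∣fromList∣≤length {m} []       = ≤-reflexive (∣⊥∣≡0 m)
  ∣fromList∣≤length (v ∷ vs) = ≤-trans (∣⁅x⁆∪p∣≤1+∣p∣ v _) (s≤s (∣fromList∣≤length vs))
    where
    ∣⁅x⁆∪p∣≤1+∣p∣ : ∀ {m} (x : Fin m) (p : Subset m) → ∣ ⁅ x ⁆ ∪ p ∣ ≤ suc ∣ p ∣
    ∣⁅x⁆∪p∣≤1+∣p∣ zero    (x ∷ p) =
      s≤s (≤-trans (≤-reflexive (cong ∣_∣ (∪-identityˡ p))) (∣p∣≤∣x∷p∣ x p))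
    ∣⁅x⁆∪p∣≤1+∣p∣ (suc i) (inside ∷ p)  = s≤s (∣⁅x⁆∪p∣≤1+∣p∣ i p)
    ∣⁅x⁆∪p∣≤1+∣p∣ (suc i) (outside ∷ p) = ∣⁅x⁆∪p∣≤1+∣p∣ i p

member : ∀ {m} (vs : List (Fin m)) (i : Fin (length vs)) → lookup vs i ∈ fromList vs
member vs i = ∈-fromList (∈-lookup i)

¬¬-∀-Subset : ∀ {m} {P : Subset m → Set} → (∀ X → ¬ ¬ P X) → ¬ ¬ (∀ X → P X)
¬¬-∀-Subset {zero}  h k = h [] λ p → k λ { [] → p }
¬¬-∀-Subset {suc m} h k =
  ¬¬-∀-Subset (λ X → h (inside ∷ X)) λ p-in →
  ¬¬-∀-Subset (λ X → h (outside ∷ X)) λ p-out →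
  k λ { (inside ∷ X) → p-in X ; (outside ∷ X) → p-out X }

-- By induction on ∣ X ∣: a non-interval X of size at most 10 would contain a minimal one.
-- IntervalOn is not decidable, hence the double negation; it is only ever used to derive ⊥.
prereduced⇒small-interval : ∀ {G} → Prereduced G → ∀ X → ∣ X ∣ ≤ 10 → ¬ ¬ IntervalOn G X
prereduced⇒small-interval {G} pre X = go X (<-wellFounded ∣ X ∣)
  where
  go : ∀ X → Acc _<_ ∣ X ∣ → ∣ X ∣ ≤ 10 → ¬ ¬ IntervalOn G X
  go X (acc rec) ∣X∣≤10 ¬interval = ¬¬-∀-Subset proper-interval λ all → pre X (¬interval , all) ∣X∣≤10
    where
    proper-interval : ∀ Y → ¬ ¬ (Y ⊂ X → IntervalOn G Y)
    proper-interval Y with Y ⊂? X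
    ... | yes Y⊂X = ¬¬-map const (go Y (rec smaller) (≤-trans (<⇒≤ smaller) ∣X∣≤10))
      where smaller = p⊂q⇒∣p∣<∣q∣ Y⊂X
    ... | no Y⊄X  = λ k → k λ Y⊂X → contradiction Y⊂X Y⊄X

prereduced⇒list-interval : ∀ {G} → Prereduced G → (vs : List (Fin (n G))) → length vs ≤ 10 →
                           ¬ ¬ IntervalOn G (fromList vs)
prereduced⇒list-interval {G} pre vs len≤10 =
  prereduced⇒small-interval {G} pre (fromList vs) (≤-trans (∣fromList∣≤length vs) len≤10)

-- Interval models

module IntervalModel {G : Graph} {X : Subset (n G)} (R : IntervalOn G X) where

  open Basics G

  private
    V : Set
    V = Fin (n G)

  lo hi : V → ℕ
  lo = proj₁ R
  hi = proj₁ (proj₂ R)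

  lo≤hi : ∀ {v} → v ∈ X → lo v ≤ hi v
  lo≤hi = proj₁ (proj₂ (proj₂ R)) _

  private
    model : ∀ {u v} → u ∈ X → v ∈ X → u ≢ v → Adj G u v ⇔ (lo u ≤ hi v × lo v ≤ hi u)
    model = proj₂ (proj₂ (proj₂ R)) _ _

  Adj⇒overlap : ∀ {u v} → u ∈ X → v ∈ X → Adj G u v → lo u ≤ hi v × lo v ≤ hi u
  Adj⇒overlap u∈ v∈ u~v = Equivalence.to (model u∈ v∈ (Adj⇒≢ u~v)) u~v

  overlap⇒Adj : ∀ {u v} → u ∈ X → v ∈ X → u ≢ v → lo u ≤ hi v → lo v ≤ hi u → Adj G u v
  overlap⇒Adj u∈ v∈ u≢v p q = Equivalence.from (model u∈ v∈ u≢v) (p , q)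

  _≺_ : V → V → Set
  u ≺ v = hi u < lo v

  ¬Adj⇒≺ : ∀ {u v} → u ∈ X → v ∈ X → u ≢ v → ¬ Adj G u v → u ≺ v ⊎ v ≺ u
  ¬Adj⇒≺ {u} {v} u∈ v∈ u≢v u≁v with lo v ≤? hi u | lo u ≤? hi v
  ... | no  p | _     = inj₁ (≰⇒> p)
  ... | yes _ | no q  = inj₂ (≰⇒> q)
  ... | yes p | yes q = ⊥-elim (u≁v (overlap⇒Adj u∈ v∈ u≢v q p))

  earliest-end-simplicial : ∀ {v u w} → v ∈ X → u ∈ X → w ∈ X → Adj G v u → Adj G v w → u ≢ w →
                            hi v ≤ hi u → hi v ≤ hi w → Adj G u w
  earliest-end-simplicial v∈ u∈ w∈ v~u v~w u≢w hv≤hu hv≤hw =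
    overlap⇒Adj u∈ w∈ u≢w (≤-trans (proj₂ (Adj⇒overlap v∈ u∈ v~u)) hv≤hw)
                          (≤-trans (proj₂ (Adj⇒overlap v∈ w∈ v~w)) hv≤hu)

  earliest-end : (v : V) (vs : List V) → Σ V λ m → m ∈ₗ (v ∷ vs) × All (λ w → hi m ≤ hi w) (v ∷ vs)
  earliest-end v []       = v , here refl , ≤-refl ∷ []
  earliest-end v (w ∷ vs) with earliest-end w vs
  ... | m , m∈ , m≤ with hi v ≤? hi m
  ...   | yes v≤m = v , here refl , ≤-refl ∷ All-map (≤-trans v≤m) m≤
  ...   | no  v≰m = m , there m∈ , <⇒≤ (≰⇒> v≰m) ∷ m≤

  no-induced-C4 : ∀ {a b c d} → a ∈ X → b ∈ X → c ∈ X → d ∈ X →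
                  Adj G a b → Adj G b c → Adj G c d → Adj G d a → a ≢ c → b ≢ d →
                  ¬ Adj G a c → ¬ Adj G b d → ⊥
  no-induced-C4 {a} {b} {c} {d} a∈ b∈ c∈ d∈ a~b b~c c~d d~a a≢c b≢d a≁c b≁d
    with earliest-end a (b ∷ c ∷ d ∷ [])
  ... | _ , here refl , _ ∷ ≤b ∷ _ ∷ ≤d ∷ [] =
    b≁d (earliest-end-simplicial a∈ b∈ d∈ a~b (Adj-sym d~a) b≢d ≤b ≤d)
  ... | _ , there (here refl) , ≤a ∷ _ ∷ ≤c ∷ _ ∷ [] =
    a≁c (earliest-end-simplicial b∈ a∈ c∈ (Adj-sym a~b) b~c a≢c ≤a ≤c)
  ... | _ , there (there (here refl)) , _ ∷ ≤b ∷ _ ∷ ≤d ∷ [] =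
    b≁d (earliest-end-simplicial c∈ b∈ d∈ (Adj-sym b~c) c~d b≢d ≤b ≤d)
  ... | _ , there (there (there (here refl))) , ≤a ∷ _ ∷ ≤c ∷ _ ∷ [] =
    a≁c (earliest-end-simplicial d∈ a∈ c∈ d~a (Adj-sym c~d) a≢c ≤a ≤c)

  no-induced-C5 : ∀ {a b c d e} → a ∈ X → b ∈ X → c ∈ X → d ∈ X → e ∈ X →
                  Adj G a b → Adj G b c → Adj G c d → Adj G d e → Adj G e a →
                  a ≢ c → b ≢ d → c ≢ e → d ≢ a → e ≢ b →
                  ¬ Adj G a c → ¬ Adj G b d → ¬ Adj G c e → ¬ Adj G d a → ¬ Adj G e b → ⊥
  no-induced-C5 {a} {b} {c} {d} {e} a∈ b∈ c∈ d∈ e∈ a~b b~c c~d d~e e~a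
                a≢c b≢d c≢e d≢a e≢b a≁c b≁d c≁e d≁a e≁b
    with earliest-end a (b ∷ c ∷ d ∷ e ∷ [])
  ... | _ , here refl , _ ∷ ≤b ∷ _ ∷ _ ∷ ≤e ∷ [] =
    e≁b (earliest-end-simplicial a∈ e∈ b∈ (Adj-sym e~a) a~b e≢b ≤e ≤b)
  ... | _ , there (here refl) , ≤a ∷ _ ∷ ≤c ∷ _ ∷ _ ∷ [] =
    a≁c (earliest-end-simplicial b∈ a∈ c∈ (Adj-sym a~b) b~c a≢c ≤a ≤c)
  ... | _ , there (there (here refl)) , _ ∷ ≤b ∷ _ ∷ ≤d ∷ _ ∷ [] =
    b≁d (earliest-end-simplicial c∈ b∈ d∈ (Adj-sym b~c) c~d b≢d ≤b ≤d)
  ... | _ , there (there (there (here refl))) , _ ∷ _ ∷ ≤c ∷ _ ∷ ≤e ∷ [] =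
    c≁e (earliest-end-simplicial d∈ c∈ e∈ (Adj-sym c~d) d~e c≢e ≤c ≤e)
  ... | _ , there (there (there (there (here refl)))) , ≤a ∷ _ ∷ _ ∷ ≤d ∷ _ ∷ [] =
    d≁a (earliest-end-simplicial e∈ d∈ a∈ (Adj-sym d~e) e~a d≢a ≤d ≤a)

  _∉N[_] : V → V → Set
  z ∉N[ m ] = z ∈ X × z ≢ m × ¬ Adj G z m

  -- Along a walk each interval starts before the previous one ends, so a walk
  -- that stays off m's interval cannot get from one side of it to the other.
  walk-cannot-cross : ∀ {m a c} → m ∈ X → Walk (_∉N[ m ]) a c → lo a ≤ hi m → lo m ≤ hi c → ⊥
  walk-cannot-cross m∈ [ a∈ , a≢m , a≁m ] la≤hm lm≤ha = a≁m (overlap⇒Adj a∈ m∈ a≢m la≤hm lm≤ha)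
  walk-cannot-cross {m} {a} m∈ ((a∈ , a≢m , a≁m) ∷⟨ a~b ⟩ w) la≤hm lm≤hc with lo m ≤? hi a
  ... | yes lm≤ha = a≁m (overlap⇒Adj a∈ m∈ a≢m la≤hm lm≤ha)
  ... | no  lm≰ha = walk-cannot-cross m∈ w lb≤hm lm≤hc
    where
    lb≤hm = ≤-trans (proj₂ (Adj⇒overlap a∈ (proj₁ (first w)) a~b))
                    (≤-trans (<⇒≤ (≰⇒> lm≰ha)) (lo≤hi m∈))

  between : ∀ {a m c} → m ∈ X → a ≺ m → m ≺ c → Walk (_∉N[ m ]) a c → ⊥
  between m∈ a≺m m≺c w =
    walk-cannot-cross m∈ w (≤-trans (lo≤hi (proj₁ (first w))) (≤-trans (<⇒≤ a≺m) (lo≤hi m∈)))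
                           (≤-trans (lo≤hi m∈) (≤-trans (<⇒≤ m≺c) (lo≤hi (proj₁ (last w)))))

  -- Membership, distinctness and non-adjacency of u, v and w are read off the walks.
  no-asteroidal-triple : ∀ {u v w} → Walk (_∉N[ w ]) u v → Walk (_∉N[ v ]) u w → Walk (_∉N[ u ]) v w → ⊥
  no-asteroidal-triple {u} {v} {w} Wuv Wuw Wvw
    with ¬Adj⇒≺ u∈ v∈ u≢v u≁v | ¬Adj⇒≺ v∈ w∈ v≢w v≁w | ¬Adj⇒≺ u∈ w∈ u≢w u≁w
    where
    u∈ = proj₁ (first Wuv) ; v∈ = proj₁ (first Wvw) ; w∈ = proj₁ (last Wvw)
    u≢v = proj₁ (proj₂ (first Wuw)) ; u≁v = proj₂ (proj₂ (first Wuw))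
    v≢w = proj₁ (proj₂ (last Wuv))  ; v≁w = proj₂ (proj₂ (last Wuv))
    u≢w = proj₁ (proj₂ (first Wuv)) ; u≁w = proj₂ (proj₂ (first Wuv))
  ... | inj₁ u≺v | inj₁ v≺w | _        = between (proj₁ (last Wuv)) u≺v v≺w Wuw
  ... | inj₂ v≺u | inj₂ w≺v | _        = between (proj₁ (last Wuv)) w≺v v≺u (reverse Wuw)
  ... | inj₁ u≺v | inj₂ w≺v | inj₁ u≺w = between (proj₁ (last Wuw)) u≺w w≺v Wuv
  ... | inj₁ u≺v | inj₂ w≺v | inj₂ w≺u = between (proj₁ (first Wuv)) w≺u u≺v (reverse Wvw)
  ... | inj₂ v≺u | inj₁ v≺w | inj₁ u≺w = between (proj₁ (first Wuv)) v≺u u≺w Wvw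
  ... | inj₂ v≺u | inj₁ v≺w | inj₂ w≺u = between (proj₁ (last Wuw)) v≺w w≺u (reverse Wuv)

module Obstructions {G : Graph} (pre : Prereduced G) where

  open Basics G

  no-C4 : ∀ {a b c d} → Adj G a b → Adj G b c → Adj G c d → Adj G d a → a ≢ c → b ≢ d →
          ¬ Adj G a c → ¬ Adj G b d → ⊥
  no-C4 {a} {b} {c} {d} a~b b~c c~d d~a a≢c b≢d a≁c b≁d =
    prereduced⇒list-interval {G} pre vs (≤ᵇ⇒≤ _ _ _) λ R →
      IntervalModel.no-induced-C4 {G} R (member vs (# 0)) (member vs (# 1)) (member vs (# 2)) (member vs (# 3))
        a~b b~c c~d d~a a≢c b≢d a≁c b≁d
    where vs = a ∷ b ∷ c ∷ d ∷ []

  no-C5 : ∀ {a b c d e} → Adj G a b → Adj G b c → Adj G c d → Adj G d e → Adj G e a →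
          a ≢ c → b ≢ d → c ≢ e → d ≢ a → e ≢ b →
          ¬ Adj G a c → ¬ Adj G b d → ¬ Adj G c e → ¬ Adj G d a → ¬ Adj G e b → ⊥
  no-C5 {a} {b} {c} {d} {e} a~b b~c c~d d~e e~a a≢c b≢d c≢e d≢a e≢b a≁c b≁d c≁e d≁a e≁b =
    prereduced⇒list-interval {G} pre vs (≤ᵇ⇒≤ _ _ _) λ R →
      IntervalModel.no-induced-C5 {G} R (member vs (# 0)) (member vs (# 1)) (member vs (# 2)) (member vs (# 3))
        (member vs (# 4)) a~b b~c c~d d~e e~a a≢c b≢d c≢e d≢a e≢b a≁c b≁d c≁e d≁a e≁b
    where vs = a ∷ b ∷ c ∷ d ∷ e ∷ []

-- Induced base paths

record Base (G : Graph) (m : ℕ) : Set where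
  field
    s      : Fin (n G)
    b      : ℕ → Fin (n G)
    b-step : ∀ k → k < m → Adj G (b k) (b (suc k))
    b-far  : ∀ i j → 2 + i ≤ j → j ≤ m → ¬ Adj G (b i) (b j)
    b-inj  : ∀ i j → i < j → j ≤ m → b i ≢ b j
    s≁b    : ∀ k → ¬ Adj G s (b k)
    s≢b    : ∀ k → s ≢ b k

module BaseLemmas {G : Graph} {m : ℕ} (B : Base G m) where

  open Basics G
  open Base B public

  private
    V : Set
    V = Fin (n G)

  s-apart : ∀ k → s ≢ b k × ¬ Adj G s (b k)
  s-apart k = s≢b k , s≁b k

  s-apart⁻ : ∀ k → b k ≢ s × ¬ Adj G (b k) s
  s-apart⁻ k = ≢-sym (s≢b k) , ¬Adj-sym (s≁b k)

  ≢b : ∀ {v} → Adj G v s → ∀ k → v ≢ b k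
  ≢b v~s k = ≢-by v~s (proj₂ (s-apart⁻ k))

  b-apart : ∀ {i j} → 2 + i ≤ j → j ≤ m → b i ≢ b j × ¬ Adj G (b i) (b j)
  b-apart {i} {j} i+2≤j j≤m = b-inj i j (≤-trans (n≤1+n _) i+2≤j) j≤m , b-far i j i+2≤j j≤m

  b-apart⁻ : ∀ {i j} → 2 + i ≤ j → j ≤ m → b j ≢ b i × ¬ Adj G (b j) (b i)
  b-apart⁻ i+2≤j j≤m with b-apart i+2≤j j≤m
  ... | bi≢bj , bi≁bj = ≢-sym bi≢bj , ¬Adj-sym bi≁bj

  b-injective : ∀ {i j} → i ≤ m → j ≤ m → b i ≡ b j → i ≡ j
  b-injective {i} {j} i≤m j≤m bi≡bj with <-cmp i j
  ... | tri< i<j _ _ = contradiction bi≡bj (b-inj i j i<j j≤m)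
  ... | tri≈ _ i≡j _ = i≡j
  ... | tri> _ _ j<i = contradiction (≡-sym bi≡bj) (b-inj j i j<i i≤m)

  Adj-b⇔ : ∀ {i j} → i ≤ m → j ≤ m → Adj G (b i) (b j) ⇔ (suc i ≡ j ⊎ suc j ≡ i)
  Adj-b⇔ {i} {j} i≤m j≤m = mk⇔ consecutive step
    where
    step : suc i ≡ j ⊎ suc j ≡ i → Adj G (b i) (b j)
    step (inj₁ refl) = b-step i j≤m
    step (inj₂ refl) = Adj-sym (b-step j i≤m)

    consecutive : Adj G (b i) (b j) → suc i ≡ j ⊎ suc j ≡ i
    consecutive bi~bj with <-cmp i j
    ... | tri≈ _ refl _ = ⊥-elim (Adj⇒≢ bi~bj refl)
    ... | tri< i<j _ _ with m≤n⇒m<n∨m≡n i<j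
    ...   | inj₂ i+1≡j = inj₁ i+1≡j
    ...   | inj₁ i+1<j = ⊥-elim (b-far i j i+1<j j≤m bi~bj)
    consecutive bi~bj | tri> _ _ j<i with m≤n⇒m<n∨m≡n j<i
    ...   | inj₂ j+1≡i = inj₂ j+1≡i
    ...   | inj₁ j+1<i = ⊥-elim (b-far j i j+1<i i≤m (Adj-sym bi~bj))

  descend : ∀ {P : V → Set} {i} k → i ≤ k → k ≤ m → (∀ t → i ≤ t → t ≤ k → P (b t)) →
            Walk P (b k) (b i)
  descend k i≤k k≤m P-on with m≤n⇒m<n∨m≡n i≤k
  ... | inj₂ refl = [ P-on k i≤k ≤-refl ]
  descend (suc k) _ k<m P-on | inj₁ (s≤s i≤k) =
    P-on (suc k) (m≤n⇒m≤1+n i≤k) ≤-refl ∷⟨ Adj-sym (b-step k k<m) ⟩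
    descend k i≤k (<⇒≤ k<m) (λ t i≤t t≤k → P-on t i≤t (m≤n⇒m≤1+n t≤k))

  prefix : ∀ {m′} → m′ ≤ m → Base G m′
  prefix m′≤m = record
    { s = s ; b = b ; s≁b = s≁b ; s≢b = s≢b
    ; b-step = λ k k<m′ → b-step k (≤-trans k<m′ m′≤m)
    ; b-far  = λ i j i+2≤j j≤m′ → b-far i j i+2≤j (≤-trans j≤m′ m′≤m)
    ; b-inj  = λ i j i<j j≤m′ → b-inj i j i<j (≤-trans j≤m′ m′≤m)
    }

  shift : ∀ o {m′} → m′ + o ≤ m → Base G m′
  shift o m′+o≤m = record
    { s = s ; b = λ k → b (k + o)
    ; s≁b = λ k → s≁b (k + o) ; s≢b = λ k → s≢b (k + o)
    ; b-step = λ k k<m′ → b-step (k + o) (≤-trans (+-monoˡ-< o k<m′) m′+o≤m)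
    ; b-far  = λ i j i+2≤j j≤m′ →
        b-far (i + o) (j + o) (+-monoˡ-≤ o i+2≤j) (≤-trans (+-monoˡ-≤ o j≤m′) m′+o≤m)
    ; b-inj  = λ i j i<j j≤m′ →
        b-inj (i + o) (j + o) (+-monoˡ-< o i<j) (≤-trans (+-monoˡ-≤ o j≤m′) m′+o≤m)
    }

module ShallowAsteroid {G : Graph} (pre : Prereduced G) {m : ℕ} (B : Base G m) where

  open Basics G
  open BaseLemmas B

  -- {s, b i, b j} is an asteroidal triple: s reaches b i through y and b j through z.
  no-shallow-asteroid :
    ∀ {i j} → 2 + i ≤ j → j ≤ 6 + i → j ≤ m →
    ∀ {y} k → Adj G s y → i ≤ k → 2 + k ≤ j → Adj G y (b k) → ¬ Adj G y (b j) →
    ∀ {z} l → Adj G s z → 2 + i ≤ l → l ≤ j → Adj G z (b l) → ¬ Adj G z (b i) → ⊥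
  no-shallow-asteroid {i} {j} i+2≤j j≤6+i j≤m
                      {y} k s~y i≤k k+2≤j y~bk y≁bj {z} l s~z i+2≤l l≤j z~bl z≁bi =
    prereduced⇒list-interval {G} pre vs size asteroid
    where
    segment = applyUpTo (λ t → b (t + i)) (suc (j ∸ i))
    vs      = s ∷ y ∷ z ∷ segment

    size : length vs ≤ 10
    size = ≤-trans (≤-reflexive (cong (3 +_) (length-applyUpTo (λ t → b (t + i)) (suc (j ∸ i)))))
                   (+-monoʳ-≤ 4 (≤-trans (∸-monoˡ-≤ i j≤6+i) (≤-reflexive (m+n∸n≡m 6 i))))

    b∈ : ∀ t → i ≤ t → t ≤ j → b t ∈ fromList vs
    b∈ t i≤t t≤j = ∈-fromList (there (there (there (subst (_∈ₗ segment) (cong b (m∸n+n≡m i≤t))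
      (∈-applyUpTo⁺ (λ t → b (t + i)) (s≤s (∸-monoˡ-≤ i t≤j)))))))

    i≤j = ≤-trans (m≤n+m i 2) i+2≤j

    asteroid : ¬ IntervalOn G (fromList vs)
    asteroid R = no-asteroidal-triple
      ((member vs (# 0) , s-apart j) ∷⟨ s~y ⟩ (member vs (# 1) , ≢b (Adj-sym s~y) j , y≁bj) ∷⟨ y~bk ⟩
        descend k i≤k (≤-trans (≤-trans (m≤n+m k 2) k+2≤j) j≤m)
          λ t i≤t t≤k → b∈ t i≤t (≤-trans (≤-trans t≤k (m≤n+m k 2)) k+2≤j) ,
                        b-apart (≤-trans (+-monoʳ-≤ 2 t≤k) k+2≤j) j≤m)
      ((member vs (# 0) , s-apart i) ∷⟨ s~z ⟩ (member vs (# 2) , ≢b (Adj-sym s~z) i , z≁bi) ∷⟨ z~bl ⟩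
        reverse (descend j l≤j j≤m λ t l≤t t≤j →
          b∈ t (≤-trans (≤-trans (m≤n+m i 2) i+2≤l) l≤t) t≤j , b-apart⁻ (≤-trans i+2≤l l≤t) (≤-trans t≤j j≤m)))
      (reverse (descend j i≤j j≤m λ t i≤t t≤j → b∈ t i≤t t≤j , s-apart⁻ t))
      where open IntervalModel R

-- Adjacency patterns of asteroidal witnesses

T-≡ᵇ : ∀ {m k} → T (m ≡ᵇ k) ⇔ (m ≡ k)
T-≡ᵇ = mk⇔ (≡ᵇ⇒≡ _ _) (≡⇒≡ᵇ _ _)

T-≤ᵇ : ∀ {m k} → T (m ≤ᵇ k) ⇔ (m ≤ k)
T-≤ᵇ = mk⇔ (≤ᵇ⇒≤ _ _) ≤⇒≤ᵇ

T-not-≡ᵇ : ∀ {m k} → T (not (m ≡ᵇ k)) ⇔ (m ≢ k)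
T-not-≡ᵇ = mk⇔
  (λ t m≡k → contradiction (Equivalence.from T-≡ᵇ m≡k) (not-T t))
  (λ m≢k → Equivalence.from T-not-≡ (¬-not λ e → m≢k (≡ᵇ⇒≡ _ _ (Equivalence.from T-≡ e))))
  where
  not-T : ∀ {x} → T (not x) → ¬ T x
  not-T {false} _ ()

T-not-≡ᵇ0 : ∀ {m} → T (not (m ≡ᵇ 0)) ⇔ (1 ≤ m)
T-not-≡ᵇ0 = ⇔-trans T-not-≡ᵇ (mk⇔ n≢0⇒n>0 >⇒≢)

T-pathAdj : ∀ {m} (i j : Fin m) → T (pathAdj i j) ⇔ (suc (toℕ i) ≡ toℕ j ⊎ suc (toℕ j) ≡ toℕ i)
T-pathAdj i j = ⇔-trans T-∨ (T-≡ᵇ ⊎-⇔ T-≡ᵇ)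

T-innerB : ∀ {d} (i : Fin (2 + d)) → T (innerB i) ⇔ (1 ≤ toℕ i × toℕ i ≤ d)
T-innerB i = mk⇔
  (λ t → let t₀ , t₁ = Equivalence.to T-∧ t in
    Equivalence.to T-not-≡ᵇ0 t₀ , ≤-pred (≤∧≢⇒< (≤-pred (toℕ<n i)) (Equivalence.to T-not-≡ᵇ t₁)))
  (λ (1≤i , i≤d) → Equivalence.from T-∧
    (Equivalence.from T-not-≡ᵇ0 1≤i , Equivalence.from T-not-≡ᵇ (<⇒≢ (s≤s i≤d))))

center-sees-shallow : ∀ {k d} (a : Lab k d) → isCenter a ≡ true → T (pat sV a)
center-sees-shallow cV  _ = _
center-sees-shallow c1V _ = _
center-sees-shallow c2V _ = _

center-sees-inner : ∀ {k d} (a : Lab k d) → isCenter a ≡ true →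
                    ∀ i → 1 ≤ toℕ i → toℕ i ≤ d → T (pat a (bV i))
center-sees-inner cV  _ i 1≤i i≤d = Equivalence.from (T-innerB i) (1≤i , i≤d)
center-sees-inner c1V _ i _   i≤d = ≤⇒≤ᵇ i≤d
center-sees-inner c2V _ i 1≤i _   = Equivalence.from T-not-≡ᵇ0 1≤i

leftCenter rightCenter : ∀ {d} (k : Kind) → Lab k d
leftCenter  dagger  = cV
leftCenter  ddagger = c2V
rightCenter dagger  = cV
rightCenter ddagger = c1V

leftCenter-isCenter : ∀ {d} k → isCenter (leftCenter {d} k) ≡ true
leftCenter-isCenter dagger  = refl
leftCenter-isCenter ddagger = refl

rightCenter-isCenter : ∀ {d} k → isCenter (rightCenter {d} k) ≡ true
rightCenter-isCenter dagger  = refl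
rightCenter-isCenter ddagger = refl

leftCenter-misses-l : ∀ {d} k → ¬ T (pat (leftCenter {d} k) (bV zero))
leftCenter-misses-l dagger  ()
leftCenter-misses-l ddagger ()

rightCenter-misses-r : ∀ {d} k (i : Fin (2 + d)) → toℕ i ≡ suc d → ¬ T (pat (rightCenter k) (bV i))
rightCenter-misses-r dagger  i i≡d+1 t = <⇒≢ (s≤s (proj₂ (Equivalence.to (T-innerB i) t))) i≡d+1
rightCenter-misses-r ddagger i i≡d+1 t = <⇒≢ (s≤s (≤ᵇ⇒≤ _ _ t)) i≡d+1

Σ-Fin⇔Σ-ℕ : ∀ {A : Set} {m p q} (f : Fin (suc m) → A) (g : ℕ → A) → (∀ i → f i ≡ g (toℕ i)) →
            q ≤ m → ∀ {v} →
            (Σ (Fin (suc m)) λ i → p ≤ toℕ i × toℕ i ≤ q × f i ≡ v) ⇔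
            (Σ ℕ λ k → p ≤ k × k ≤ q × g k ≡ v)
Σ-Fin⇔Σ-ℕ {A} {m} {p} {q} f g f≗g q≤m {v} = mk⇔
  (λ (i , p≤i , i≤q , fi≡v) → toℕ i , p≤i , i≤q , ≡-trans (≡-sym (f≗g i)) fi≡v)
  (λ (k , p≤k , k≤q , gk≡v) → let k<1+m = s≤s (≤-trans k≤q q≤m) ; i≡k = toℕ-fromℕ< k<1+m in
     fromℕ< k<1+m , subst (p ≤_) (≡-sym i≡k) p≤k , subst (_≤ q) (≡-sym i≡k) k≤q ,
     ≡-trans (f≗g _) (subst (λ t → g t ≡ v) (≡-sym i≡k) gk≡v))

Σ-shift : ∀ {A : Set} (g : ℕ → A) o m {v} →
          (Σ ℕ λ k → 1 ≤ k × k ≤ m × g (k + o) ≡ v) ⇔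
          (Σ ℕ λ k → suc o ≤ k × k ≤ m + o × g k ≡ v)
Σ-shift g o m {v} = mk⇔
  (λ (k , 1≤k , k≤m , e) → k + o , +-monoˡ-≤ o 1≤k , +-monoˡ-≤ o k≤m , e)
  (λ (k , o<k , k≤m+o , e) →
     k ∸ o , ≤-trans (≤-reflexive (≡-sym (m+n∸n≡m 1 o))) (∸-monoˡ-≤ o o<k) ,
     ≤-trans (∸-monoˡ-≤ o k≤m+o) (≤-reflexive (m+n∸n≡m m o)) ,
     subst (λ t → g t ≡ v) (≡-sym (m∸n+n≡m (<⇒≤ o<k))) e)

InBase⇔ : ∀ {G} (W : AW G) (g : ℕ → Fin (n G)) → (∀ i → bAt W i ≡ g (toℕ i)) → ∀ {v} →
          InBase W v ⇔ (Σ ℕ λ k → 1 ≤ k × k ≤ d W × g k ≡ v)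
InBase⇔ W g bAt≗g = ⇔-trans
  (mk⇔ (λ (i , (1≤i , i≤d) , e) → i , 1≤i , i≤d , e) (λ (i , 1≤i , i≤d , e) → i , (1≤i , i≤d) , e))
  (Σ-Fin⇔Σ-ℕ (bAt W) g bAt≗g (n≤1+n _))

module Builders {G : Graph} {m : ℕ} (B : Base G (suc m)) where

  open Basics G
  open BaseLemmas B

  private
    V : Set
    V = Fin (n G)

    bound : ∀ {k} (t : Fin (2 + k)) → toℕ t ≤ suc k
    bound t = ≤-pred (toℕ<n t)

  base-pattern : ∀ (t u : Fin (2 + m)) → adj G (b (toℕ t)) (b (toℕ u)) ≡ pathAdj t u
  base-pattern t u = Adj⇔T⇒adj≡ (⇔-trans (Adj-b⇔ (bound t) (bound u)) (⇔-sym (T-pathAdj t u)))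

  misses-l⇒1≤ : ∀ {c k} → ¬ Adj G c (b 0) → Adj G c (b k) → 1 ≤ k
  misses-l⇒1≤ {c} c≁l c~bk = n≢0⇒n>0 λ k≡0 → c≁l (subst (λ k → Adj G c (b k)) k≡0 c~bk)

  misses-r⇒≤ : ∀ {c k} → ¬ Adj G c (b (suc m)) → k ≤ suc m → Adj G c (b k) → k ≤ m
  misses-r⇒≤ {c} c≁r k≤1+m c~bk =
    ≤-pred (≤∧≢⇒< k≤1+m λ k≡1+m → c≁r (subst (λ k → Adj G c (b k)) k≡1+m c~bk))

  b-toℕ-injective : ∀ {t u : Fin (2 + m)} → b (toℕ t) ≡ b (toℕ u) → t ≡ u
  b-toℕ-injective {t} {u} e = toℕ-injective (b-injective (bound t) (bound u) e)

  module Dagger (3≤m : 3 ≤ m) {c : V} (s~c : Adj G s c) (c≁l : ¬ Adj G c (b 0)) (c≁r : ¬ Adj G c (b (suc m)))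
                (c~B : ∀ k → 1 ≤ k → k ≤ m → Adj G c (b k)) where

    f : Lab dagger m → V
    f sV     = s
    f cV     = c
    f (bV t) = b (toℕ t)

    c~s : Adj G c s
    c~s = Adj-sym s~c

    c-pattern : ∀ t → adj G c (b (toℕ t)) ≡ innerB t
    c-pattern t = Adj⇔T⇒adj≡ (⇔-trans
      (mk⇔ (λ c~bt → misses-l⇒1≤ c≁l c~bt , misses-r⇒≤ c≁r (bound t) c~bt)
           (λ (1≤t , t≤m) → c~B _ 1≤t t≤m))
      (⇔-sym (T-innerB t)))

    f-inj : ∀ {u v} → f u ≡ f v → u ≡ v
    f-inj {sV}   {sV}   _ = refl
    f-inj {sV}   {cV}   e = ⊥-elim (Adj⇒≢ s~c e)
    f-inj {sV}   {bV u} e = ⊥-elim (s≢b _ e)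
    f-inj {cV}   {sV}   e = ⊥-elim (Adj⇒≢ s~c (≡-sym e))
    f-inj {cV}   {cV}   _ = refl
    f-inj {cV}   {bV u} e = ⊥-elim (≢b c~s _ e)
    f-inj {bV t} {sV}   e = ⊥-elim (s≢b _ (≡-sym e))
    f-inj {bV t} {cV}   e = ⊥-elim (≢b c~s _ (≡-sym e))
    f-inj {bV t} {bV u} e = cong bV (b-toℕ-injective e)

    f-pattern : ∀ u v → adj G (f u) (f v) ≡ pat u v
    f-pattern sV     sV     = irrefl G s
    f-pattern sV     cV     = s~c
    f-pattern sV     (bV u) = ¬Adj⇒adj≡false (s≁b _)
    f-pattern cV     sV     = c~s
    f-pattern cV     cV     = irrefl G c
    f-pattern cV     (bV u) = c-pattern u
    f-pattern (bV t) sV     = ¬Adj⇒adj≡false (¬Adj-sym (s≁b _))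
    f-pattern (bV t) cV     = ≡-trans (sym G _ c) (c-pattern t)
    f-pattern (bV t) (bV u) = base-pattern t u

    daggerAW : AW G
    daggerAW = record { kind = dagger ; d = m ; emb = f ; isAW = 3≤m , f-inj , f-pattern }

  module DDagger (2≤m : 2 ≤ m) {c₁ c₂ : V}
                 (s~c₁ : Adj G s c₁) (s~c₂ : Adj G s c₂) (c₁~c₂ : Adj G c₁ c₂)
                 (c₁~B : ∀ k → k ≤ m → Adj G c₁ (b k)) (c₁≁r : ¬ Adj G c₁ (b (suc m)))
                 (c₂≁l : ¬ Adj G c₂ (b 0)) (c₂~B : ∀ k → 1 ≤ k → k ≤ suc m → Adj G c₂ (b k)) where

    f : Lab ddagger m → V
    f sV     = s
    f c1V    = c₁
    f c2V    = c₂
    f (bV t) = b (toℕ t)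

    c₁~s : Adj G c₁ s
    c₁~s = Adj-sym s~c₁

    c₂~s : Adj G c₂ s
    c₂~s = Adj-sym s~c₂

    c₁-pattern : ∀ t → adj G c₁ (b (toℕ t)) ≡ (toℕ t ≤ᵇ m)
    c₁-pattern t = Adj⇔T⇒adj≡ (⇔-trans (mk⇔ (misses-r⇒≤ c₁≁r (bound t)) (c₁~B _))
                                        (⇔-sym T-≤ᵇ))

    c₂-pattern : ∀ t → adj G c₂ (b (toℕ t)) ≡ not (toℕ t ≡ᵇ 0)
    c₂-pattern t = Adj⇔T⇒adj≡ (⇔-trans (mk⇔ (misses-l⇒1≤ c₂≁l) (λ 1≤t → c₂~B _ 1≤t (bound t)))
                                        (⇔-sym T-not-≡ᵇ0))

    f-inj : ∀ {u v} → f u ≡ f v → u ≡ v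
    f-inj {sV}   {sV}   _ = refl
    f-inj {sV}   {c1V}  e = ⊥-elim (Adj⇒≢ s~c₁ e)
    f-inj {sV}   {c2V}  e = ⊥-elim (Adj⇒≢ s~c₂ e)
    f-inj {sV}   {bV u} e = ⊥-elim (s≢b _ e)
    f-inj {c1V}  {sV}   e = ⊥-elim (Adj⇒≢ s~c₁ (≡-sym e))
    f-inj {c1V}  {c1V}  _ = refl
    f-inj {c1V}  {c2V}  e = ⊥-elim (Adj⇒≢ c₁~c₂ e)
    f-inj {c1V}  {bV u} e = ⊥-elim (≢b c₁~s _ e)
    f-inj {c2V}  {sV}   e = ⊥-elim (Adj⇒≢ s~c₂ (≡-sym e))
    f-inj {c2V}  {c1V}  e = ⊥-elim (Adj⇒≢ c₁~c₂ (≡-sym e))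
    f-inj {c2V}  {c2V}  _ = refl
    f-inj {c2V}  {bV u} e = ⊥-elim (≢b c₂~s _ e)
    f-inj {bV t} {sV}   e = ⊥-elim (s≢b _ (≡-sym e))
    f-inj {bV t} {c1V}  e = ⊥-elim (≢b c₁~s _ (≡-sym e))
    f-inj {bV t} {c2V}  e = ⊥-elim (≢b c₂~s _ (≡-sym e))
    f-inj {bV t} {bV u} e = cong bV (b-toℕ-injective e)

    f-pattern : ∀ u v → adj G (f u) (f v) ≡ pat u v
    f-pattern sV     sV     = irrefl G s
    f-pattern sV     c1V    = s~c₁
    f-pattern sV     c2V    = s~c₂
    f-pattern sV     (bV u) = ¬Adj⇒adj≡false (s≁b _)
    f-pattern c1V    sV     = c₁~s
    f-pattern c1V    c1V    = irrefl G c₁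
    f-pattern c1V    c2V    = c₁~c₂
    f-pattern c1V    (bV u) = c₁-pattern u
    f-pattern c2V    sV     = c₂~s
    f-pattern c2V    c1V    = Adj-sym c₁~c₂
    f-pattern c2V    c2V    = irrefl G c₂
    f-pattern c2V    (bV u) = c₂-pattern u
    f-pattern (bV t) sV     = ¬Adj⇒adj≡false (¬Adj-sym (s≁b _))
    f-pattern (bV t) c1V    = ≡-trans (sym G _ c₁) (c₁-pattern t)
    f-pattern (bV t) c2V    = ≡-trans (sym G _ c₂) (c₂-pattern t)
    f-pattern (bV t) (bV u) = base-pattern t u

    ddaggerAW : AW G
    ddaggerAW = record { kind = ddagger ; d = m ; emb = f ; isAW = 2≤m , f-inj , f-pattern }

-- Maximal runs

module _ {P : ℕ → Set} (P? : ∀ k → Dec (P k)) where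

  grow-down : ∀ i → P i → Σ ℕ λ p → p ≤ i × (∀ k → p ≤ k → k ≤ i → P k) ×
                                     (p ≡ 0 ⊎ Σ ℕ λ o → p ≡ suc o × ¬ P o)
  grow-down zero P0 = 0 , z≤n , (λ k _ k≤0 → subst P (≡-sym (n≤0⇒n≡0 k≤0)) P0) , inj₁ refl
  grow-down (suc i) Pi+1 with P? i
  ... | no ¬Pi =
    suc i , ≤-refl , (λ k i<k k≤i+1 → subst P (≤-antisym i<k k≤i+1) Pi+1) , inj₂ (i , refl , ¬Pi)
  ... | yes Pi with grow-down i Pi
  ...   | p , p≤i , filled , left-end = p , m≤n⇒m≤1+n p≤i , extended , left-end
    where
    extended : ∀ k → p ≤ k → k ≤ suc i → P k
    extended k p≤k k≤i+1 with m≤n⇒m<n∨m≡n k≤i+1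
    ... | inj₁ k<i+1 = filled k p≤k (≤-pred k<i+1)
    ... | inj₂ refl  = Pi+1

  grow-up : ∀ {i} m → i ≤ m → P i → Σ ℕ λ q → i ≤ q × q ≤ m × (∀ k → i ≤ k → k ≤ q → P k) ×
                                                 (q ≡ m ⊎ q < m × ¬ P (suc q))
  grow-up m i≤m Pi with m≤n⇒m<n∨m≡n i≤m
  ... | inj₂ refl = m , ≤-refl , ≤-refl , (λ k i≤k k≤i → subst P (≤-antisym i≤k k≤i) Pi) , inj₁ refl
  grow-up {i} (suc m) _ Pi | inj₁ (s≤s i≤m) with grow-up m i≤m Pi
  ... | q , i≤q , q≤m , filled , inj₂ (q<m , ¬Pq+1) =
    q , i≤q , m≤n⇒m≤1+n q≤m , filled , inj₂ (m<n⇒m<1+n q<m , ¬Pq+1)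
  ... | q , i≤q , q≤m , filled , inj₁ refl with P? (suc q)
  ...   | no ¬Pq+1 = q , i≤q , n≤1+n q , filled , inj₂ (n<1+n q , ¬Pq+1)
  ...   | yes Pq+1 = suc q , m≤n⇒m≤1+n i≤q , ≤-refl , extended , inj₁ refl
    where
    extended : ∀ k → i ≤ k → k ≤ suc q → P k
    extended k i≤k k≤q+1 with m≤n⇒m<n∨m≡n k≤q+1
    ... | inj₁ k<q+1 = filled k i≤k (≤-pred k<q+1)
    ... | inj₂ refl  = Pq+1

  maximal-run : ∀ {i m} → i ≤ m → P i →
    Σ ℕ λ p → Σ ℕ λ q → p ≤ i × i ≤ q × q ≤ m × (∀ k → p ≤ k → k ≤ q → P k) ×
                        (p ≡ 0 ⊎ Σ ℕ λ o → p ≡ suc o × ¬ P o) × (q ≡ m ⊎ q < m × ¬ P (suc q))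
  maximal-run {i} {m} i≤m Pi with grow-down i Pi | grow-up m i≤m Pi
  ... | p , p≤i , filled↓ , left-end | q , i≤q , q≤m , filled↑ , right-end =
    p , q , p≤i , i≤q , q≤m , filled , left-end , right-end
    where
    filled : ∀ k → p ≤ k → k ≤ q → P k
    filled k p≤k k≤q with k ≤? i
    ... | yes k≤i = filled↓ k p≤k k≤i
    ... | no  k≰i = filled↑ k (<⇒≤ (≰⇒> k≰i)) k≤q

-- The neighbourhood of s

-- An AW with d = m seen from its shallow terminal s: cL = cR = c for a †-AW, and
-- (cL, cR) = (c₂, c₁) for a ‡-AW.
record Skeleton (G : Graph) : Set where
  field
    m     : ℕ
    3≤m   : 3 ≤ m
    base  : Base G (suc m)
    cL cR : Fin (n G)
  open Base base
  field
    s~cL : Adj G s cL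
    s~cR : Adj G s cR
    cL≁l : ¬ Adj G cL (b 0)
    cR≁r : ¬ Adj G cR (b (suc m))
    cL~B : ∀ k → 1 ≤ k → k ≤ m → Adj G cL (b k)
    cR~B : ∀ k → 1 ≤ k → k ≤ m → Adj G cR (b k)

module SkeletonLemmas {G : Graph} (pre : Prereduced G) (S : Skeleton G) where

  open Basics G
  open Skeleton S
  open BaseLemmas base public
  open Obstructions {G} pre
  open ShallowAsteroid pre base

  private
    V : Set
    V = Fin (n G)

    2≤m : 2 ≤ m
    2≤m = ≤-trans (n≤1+n 2) 3≤m

    1≤m : 1 ≤ m
    1≤m = ≤-trans (n≤1+n 1) 2≤m

  B-full : V → Set
  B-full z = ∀ k → 1 ≤ k → k ≤ m → Adj G z (b k)

  -- x ≁ z forces x off the base (by C4 and C5), and then {x, l, r} is an asteroidal triple.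
  adjacent-to-B-full : ∀ {x z} → Adj G x s → Adj G s z → B-full z → x ≢ z → Adj G x z
  adjacent-to-B-full {x} {z} x~s s~z z-full x≢z with Adj? x z
  ... | yes x~z = x~z
  ... | no  x≁z = ⊥-elim (prereduced⇒list-interval {G} pre vs (≤ᵇ⇒≤ _ _ _) asteroid)
    where
    z~s = Adj-sym s~z

    x≁inner : ∀ k → 1 ≤ k → k ≤ m → ¬ Adj G x (b k)
    x≁inner k 1≤k k≤m x~bk = no-C4 x~s s~z (z-full k 1≤k k≤m) (Adj-sym x~bk) x≢z (s≢b k) x≁z (s≁b k)

    x≁end : ∀ {t t′} → Adj G (b t) (b t′) → 1 ≤ t′ → t′ ≤ m → ¬ Adj G x (b t)
    x≁end {t} {t′} bt~bt′ 1≤t′ t′≤m x~bt with Adj? z (b t)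
    ... | yes z~bt = no-C4 x~s s~z z~bt (Adj-sym x~bt) x≢z (s≢b t) x≁z (s≁b t)
    ... | no  z≁bt = no-C5 x~bt bt~bt′ (Adj-sym (z-full t′ 1≤t′ t′≤m)) z~s (Adj-sym x~s)
                       (≢b x~s t′) (≢-sym (≢b z~s t)) (proj₁ (s-apart⁻ t′)) (≢-sym x≢z) (s≢b t)
                       (x≁inner t′ 1≤t′ t′≤m) (¬Adj-sym z≁bt) (proj₂ (s-apart⁻ t′))
                       (¬Adj-sym x≁z) (s≁b t)

    x≁l : ¬ Adj G x (b 0)
    x≁l = x≁end (b-step 0 (s≤s z≤n)) ≤-refl (≤-trans (n≤1+n 1) 2≤m)

    x≁r : ¬ Adj G x (b (suc m))
    x≁r = x≁end (Adj-sym (b-step m ≤-refl)) (≤-trans (n≤1+n 1) 2≤m) ≤-refl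

    vs = x ∷ s ∷ cL ∷ cR ∷ z ∷ b 0 ∷ b 1 ∷ b m ∷ b (suc m) ∷ []

    asteroid : ¬ IntervalOn G (fromList vs)
    asteroid R = no-asteroidal-triple
      ((member vs (# 0) , ≢b x~s _ , x≁r) ∷⟨ x~s ⟩ (member vs (# 1) , s-apart _) ∷⟨ s~cR ⟩
       (member vs (# 3) , ≢b (Adj-sym s~cR) _ , cR≁r) ∷⟨ cR~B 1 ≤-refl 1≤m ⟩
       (member vs (# 6) , b-apart (s≤s 2≤m) ≤-refl) ∷⟨ Adj-sym (b-step 0 (s≤s z≤n)) ⟩
       [ member vs (# 5) , b-apart (s≤s 1≤m) ≤-refl ])
      ((member vs (# 0) , ≢b x~s _ , x≁l) ∷⟨ x~s ⟩ (member vs (# 1) , s-apart _) ∷⟨ s~cL ⟩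
       (member vs (# 2) , ≢b (Adj-sym s~cL) _ , cL≁l) ∷⟨ cL~B m 1≤m ≤-refl ⟩
       (member vs (# 7) , b-apart⁻ 2≤m (n≤1+n m)) ∷⟨ b-step m ≤-refl ⟩
       [ member vs (# 8) , b-apart⁻ (s≤s 1≤m) ≤-refl ])
      ((member vs (# 5) , ≢-sym (≢b x~s 0) , ¬Adj-sym x≁l) ∷⟨ b-step 0 (s≤s z≤n) ⟩
       (member vs (# 6) , ≢-sym (≢b x~s 1) , ¬Adj-sym (x≁inner 1 ≤-refl 1≤m)) ∷⟨
         Adj-sym (z-full 1 ≤-refl 1≤m) ⟩
       (member vs (# 4) , ≢-sym x≢z , ¬Adj-sym x≁z) ∷⟨ z-full m 1≤m ≤-refl ⟩
       (member vs (# 7) , ≢-sym (≢b x~s m) , ¬Adj-sym (x≁inner m 1≤m ≤-refl)) ∷⟨ b-step m ≤-refl ⟩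
       [ member vs (# 8) , ≢-sym (≢b x~s _) , ¬Adj-sym x≁r ])
      where
      open IntervalModel R

  misses-ends : ∀ {x} → Adj G x s → (∀ k → 1 ≤ k → k ≤ m → ¬ Adj G x (b k)) →
                ¬ Adj G x (b 0) × ¬ Adj G x (b (suc m))
  misses-ends {x} x~s x≁B = x≁l , x≁r
    where
    x~cL = adjacent-to-B-full x~s s~cL cL~B (≢-sym (≢-by (cL~B 1 ≤-refl 1≤m) (x≁B 1 ≤-refl 1≤m)))
    x~cR = adjacent-to-B-full x~s s~cR cR~B (≢-sym (≢-by (cR~B m 1≤m ≤-refl) (x≁B m 1≤m ≤-refl)))

    x≁l : ¬ Adj G x (b 0)
    x≁l x~l = no-C4 x~l (b-step 0 (s≤s z≤n)) (Adj-sym (cL~B 1 ≤-refl 1≤m)) (Adj-sym x~cL)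
                (≢b x~s 1) (≢-sym (≢b (Adj-sym s~cL) 0)) (x≁B 1 ≤-refl 1≤m) (¬Adj-sym cL≁l)

    x≁r : ¬ Adj G x (b (suc m))
    x≁r x~r = no-C4 x~r (Adj-sym (b-step m ≤-refl)) (Adj-sym (cR~B m 1≤m ≤-refl)) (Adj-sym x~cR)
                (≢b x~s m) (≢-sym (≢b (Adj-sym s~cR) _)) (x≁B m 1≤m ≤-refl) (¬Adj-sym cR≁r)

  SubAW : V → ℕ → ℕ → Set
  SubAW x p q = Σ (AW G) λ W′ → shallow W′ ≡ s × IsCenterOf W′ x ×
                  (∀ v → InBase W′ v ⇔ Σ ℕ λ k → p ≤ k × k ≤ q × b k ≡ v)

  Outcome : V → Set
  Outcome x = Σ ℕ λ p → Σ ℕ λ q → 1 ≤ p × p ≤ q × q ≤ m × ¬ (p ≡ 1 × q ≡ m) × SubAW x p q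

  module Trace {x} (x~s : Adj G x s) (x~cL : Adj G x cL) (x~cR : Adj G x cR)
               {j} (1≤j : 1 ≤ j) (j≤m : j ≤ m) (¬Nj : ¬ Adj G x (b j)) where

    N : ℕ → Set
    N k = Adj G x (b k)

    private
      s~x : Adj G s x
      s~x = Adj-sym x~s

    no-gap : ∀ {a} → 2 + a ≤ suc m → N a → ¬ N (1 + a) → ¬ N (2 + a)
    no-gap {a} a+2≤ Na ¬Na+1 Na+2 =
      no-C4 Na (b-step a (≤-trans (n≤1+n _) a+2≤)) (b-step (suc a) a+2≤) (Adj-sym Na+2)
            (≢b x~s (suc a)) (proj₁ (b-apart ≤-refl a+2≤)) ¬Na+1 (proj₂ (b-apart ≤-refl a+2≤))

    no-gap⁻ : ∀ {a} → 2 + a ≤ suc m → N (2 + a) → ¬ N (1 + a) → ¬ N a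
    no-gap⁻ a+2≤ Na+2 ¬Na+1 Na = no-gap a+2≤ Na ¬Na+1 Na+2

    no-short-left : N 0 → ¬ N 2 → ⊥
    no-short-left N0 ¬N2 =
      no-shallow-asteroid {0} {2} ≤-refl (≤ᵇ⇒≤ _ _ _) (m≤n⇒m≤1+n 2≤m)
        0 s~x z≤n ≤-refl N0 ¬N2 2 s~cL ≤-refl ≤-refl (cL~B 2 (s≤s z≤n) 2≤m) cL≁l

    no-short-right : ∀ {o} → suc o ≡ m → ¬ N o → N (suc m) → ⊥
    no-short-right {o} o+1≡m ¬No Nm+1 =
      no-shallow-asteroid {o} {2 + o} ≤-refl (+-monoˡ-≤ o (≤ᵇ⇒≤ 2 6 _)) (≤-reflexive (cong suc o+1≡m))
        o s~cR ≤-refl ≤-refl (cR~B o 1≤o (subst (o ≤_) o+1≡m (n≤1+n o)))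
          (subst (λ k → ¬ Adj G cR (b (suc k))) (≡-sym o+1≡m) cR≁r)
        (2 + o) s~x ≤-refl ≤-refl (subst (λ k → N (suc k)) (≡-sym o+1≡m) Nm+1) ¬No
      where 1≤o = ≤-trans (n≤1+n 1) (≤-pred (subst (3 ≤_) (≡-sym o+1≡m) 3≤m))

    no-isolated : ∀ {a} → a < m → ¬ N a → N (1 + a) → ¬ N (2 + a) → ⊥
    no-isolated {zero} _ ¬N0 N1 ¬N2 =
      no-shallow-asteroid {0} {3} (s≤s (s≤s z≤n)) (≤ᵇ⇒≤ _ _ _) (m≤n⇒m≤1+n 3≤m)
        1 s~x z≤n ≤-refl N1 (no-gap (m≤n⇒m≤1+n 3≤m) N1 ¬N2)
        3 s~cL (s≤s (s≤s z≤n)) ≤-refl (cL~B 3 (s≤s z≤n) 3≤m) cL≁l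
    no-isolated {suc a} a+1<m ¬Na+1 Na+2 ¬Na+3 with m≤n⇒m<n∨m≡n a+1<m
    ... | inj₂ a+2≡m =
      no-shallow-asteroid {a} {3 + a} (n≤1+n _) (+-monoˡ-≤ a (≤ᵇ⇒≤ 3 6 _)) (≤-reflexive (cong suc a+2≡m))
        a s~cR ≤-refl (n≤1+n _) (cR~B a 1≤a a≤m) (subst (λ k → ¬ Adj G cR (b (suc k))) (≡-sym a+2≡m) cR≁r)
        (2 + a) s~x ≤-refl (n≤1+n _) Na+2 (no-gap⁻ (m≤n⇒m≤1+n a+1<m) Na+2 ¬Na+1)
      where
      1≤a = ≤-pred (≤-pred (subst (3 ≤_) (≡-sym a+2≡m) 3≤m))
      a≤m = ≤-trans (m≤n+m a 2) (≤-reflexive a+2≡m)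
    ... | inj₁ a+3≤m =
      no-shallow-asteroid {a} {4 + a} (+-monoˡ-≤ a (≤ᵇ⇒≤ 2 4 _)) (+-monoˡ-≤ a (≤ᵇ⇒≤ 4 6 _)) (s≤s a+3≤m)
        (2 + a) s~x (m≤n+m a 2) ≤-refl Na+2 (no-gap (s≤s a+3≤m) Na+2 ¬Na+3)
        (2 + a) s~x ≤-refl (+-monoˡ-≤ a (≤ᵇ⇒≤ 2 4 _)) Na+2 (no-gap⁻ (m≤n⇒m≤1+n a+1<m) Na+2 ¬Na+1)

    no-pair : ∀ {a} → 3 + a ≤ suc m → ¬ N a → N (1 + a) → N (2 + a) → ¬ N (3 + a) → ⊥
    no-pair {a} a+3≤ ¬Na Na+1 Na+2 ¬Na+3 =
      no-shallow-asteroid {a} {3 + a} (n≤1+n _) (+-monoˡ-≤ a (≤ᵇ⇒≤ 3 6 _)) a+3≤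
        (1 + a) s~x (n≤1+n a) ≤-refl Na+1 ¬Na+3 (2 + a) s~x ≤-refl (n≤1+n _) Na+2 ¬Na

    left-block : ∀ q → 1 ≤ q → q ≤ m → (∀ k → k ≤ q → N k) → ¬ N (suc q) → Outcome x
    left-block (suc zero) _ _ N≤1 ¬N2 = ⊥-elim (no-short-left (N≤1 0 z≤n) ¬N2)
    left-block q@(suc (suc _)) _ q≤m N≤q ¬Nq+1 with q ≟ m
    ... | yes q≡m = ⊥-elim (¬Nj (N≤q j (subst (j ≤_) (≡-sym q≡m) j≤m)))
    ... | no  q≢m = 1 , q , ≤-refl , s≤s z≤n , q≤m , (λ (_ , q≡m) → q≢m q≡m) ,
                    ddaggerAW , refl , (c1V , refl , refl) , λ _ → InBase⇔ ddaggerAW b λ _ → refl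
      where
      open Builders (prefix (s≤s q≤m))
      open DDagger (s≤s (s≤s z≤n)) s~x s~cL x~cL N≤q ¬Nq+1 cL≁l
                   (λ k 1≤k k≤q+1 → cL~B k 1≤k (≤-trans k≤q+1 (≤∧≢⇒< q≤m q≢m)))

    right-block : ∀ o d′ → d′ + o ≡ m → 1 ≤ d′ → ¬ N o → (∀ k → suc o ≤ k → k ≤ suc m → N k) → Outcome x
    right-block zero _ _ _ _ N≥1 = ⊥-elim (¬Nj (N≥1 j 1≤j (m≤n⇒m≤1+n j≤m)))
    right-block (suc o) (suc zero) o+2≡m _ ¬No N≥ =
      ⊥-elim (no-short-right o+2≡m ¬No (N≥ (suc m) (m≤n⇒m≤1+n (≤-reflexive o+2≡m)) ≤-refl))
    right-block o@(suc _) d′@(suc (suc _)) d′+o≡m _ ¬No N≥ =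
      suc o , d′ + o , s≤s z≤n , +-monoˡ-≤ o {1} {d′} (s≤s z≤n) , ≤-reflexive d′+o≡m , (λ { (() , _) }) ,
      ddaggerAW , refl , (c2V , refl , refl) ,
      λ _ → ⇔-trans (InBase⇔ ddaggerAW (λ k → b (k + o)) λ _ → refl) (Σ-shift b o d′)
      where
      open Builders (shift o {suc d′} (≤-reflexive (cong suc d′+o≡m)))
      open DDagger (s≤s (s≤s z≤n)) s~cR s~x (Adj-sym x~cR)
                   (λ k k≤d′ → cR~B (k + o) (≤-trans (s≤s z≤n) (m≤n+m o k))
                                     (≤-trans (+-monoˡ-≤ o k≤d′) (≤-reflexive d′+o≡m)))
                   (subst (λ k → ¬ Adj G cR (b (suc k))) (≡-sym d′+o≡m) cR≁r) ¬No
                   (λ k 1≤k k≤d′+1 → N≥ (k + o) (+-monoˡ-≤ o 1≤k)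
                                          (≤-trans (+-monoˡ-≤ o k≤d′+1) (≤-reflexive (cong suc d′+o≡m))))

    inner-block : ∀ o d′ → d′ + o ≤ m → 1 ≤ d′ → ¬ N o → (∀ k → suc o ≤ k → k ≤ d′ + o → N k) →
                  ¬ N (suc (d′ + o)) → Outcome x
    inner-block o 1 o<m _ ¬No N≤ ¬No+2 = ⊥-elim (no-isolated o<m ¬No (N≤ (suc o) ≤-refl ≤-refl) ¬No+2)
    inner-block o 2 o+2≤m _ ¬No N≤ ¬No+3 =
      ⊥-elim (no-pair (s≤s o+2≤m) ¬No (N≤ (suc o) ≤-refl (n≤1+n _)) (N≤ (2 + o) (n≤1+n _) ≤-refl) ¬No+3)
    inner-block o d′@(suc (suc (suc _))) d′+o≤m _ ¬No N≤ ¬Nq+1 =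
      suc o , d′ + o , s≤s z≤n , +-monoˡ-≤ o {1} {d′} (s≤s z≤n) , d′+o≤m ,
      (λ (o+1≡1 , q≡m) → ¬Nj (N≤ j (subst (_≤ j) (≡-sym o+1≡1) 1≤j) (subst (j ≤_) (≡-sym q≡m) j≤m))) ,
      daggerAW , refl , (cV , refl , refl) ,
      λ _ → ⇔-trans (InBase⇔ daggerAW (λ k → b (k + o)) λ _ → refl) (Σ-shift b o d′)
      where
      open Builders (shift o {suc d′} (s≤s d′+o≤m))
      open Dagger (s≤s (s≤s (s≤s z≤n))) s~x ¬No ¬Nq+1
                  (λ k 1≤k k≤d′ → N≤ (k + o) (+-monoˡ-≤ o 1≤k) (+-monoˡ-≤ o k≤d′))

    outcome-of-run : ∀ {i} p q → 1 ≤ i → i ≤ m → p ≤ i → i ≤ q → (∀ k → p ≤ k → k ≤ q → N k) →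
               (p ≡ 0 ⊎ Σ ℕ λ o → p ≡ suc o × ¬ N o) → (q ≡ suc m ⊎ q < suc m × ¬ N (suc q)) → Outcome x
    outcome-of-run _ _ _ _ _ _ filled (inj₁ refl) (inj₁ refl) = ⊥-elim (¬Nj (filled j z≤n (m≤n⇒m≤1+n j≤m)))
    outcome-of-run _ q 1≤i _ _ i≤q filled (inj₁ refl) (inj₂ (q<m+1 , ¬Nq+1)) =
      left-block q (≤-trans 1≤i i≤q) (≤-pred q<m+1) (λ k → filled k z≤n) ¬Nq+1
    outcome-of-run _ _ _ i≤m o<i _ filled (inj₂ (o , refl , ¬No)) (inj₁ refl) =
      right-block o (m ∸ o) (m∸n+n≡m (≤-trans (n≤1+n o) o<m))
                  (≤-trans (≤-reflexive (≡-sym (m+n∸n≡m 1 o))) (∸-monoˡ-≤ o o<m)) ¬No filled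
      where o<m = ≤-trans o<i i≤m
    outcome-of-run _ q _ _ o<i i≤q filled (inj₂ (o , refl , ¬No)) (inj₂ (q<m+1 , ¬Nq+1))
      with q ∸ o | m∸n+n≡m (≤-trans (n≤1+n o) (≤-trans o<i i≤q))
    ... | d′ | refl =
      inner-block o d′ (≤-pred q<m+1) (+-cancelʳ-≤ o 1 d′ (≤-trans o<i i≤q)) ¬No filled ¬Nq+1

  partial-neighbour : ∀ {x i j} → Adj G x s → 1 ≤ i → i ≤ m → Adj G x (b i) →
                      1 ≤ j → j ≤ m → ¬ Adj G x (b j) → Outcome x
  partial-neighbour {x} {i} {j} x~s 1≤i i≤m x~bi 1≤j j≤m x≁bj
    with maximal-run (λ k → Adj? x (b k)) (m≤n⇒m≤1+n i≤m) x~bi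
  ... | p , q , p≤i , i≤q , _ , filled , left-end , right-end =
    outcome-of-run p q 1≤i i≤m p≤i i≤q filled left-end right-end
    where
    x~cL = adjacent-to-B-full x~s s~cL cL~B (≢-sym (≢-by (cL~B j 1≤j j≤m) x≁bj))
    x~cR = adjacent-to-B-full x~s s~cR cR~B (≢-sym (≢-by (cR~B j 1≤j j≤m) x≁bj))
    open Trace x~s x~cL x~cR 1≤j j≤m x≁bj

-- Skeletons of asteroidal witnesses

module FromAW {G : Graph} (W : AW G) where

  open Basics G

  private
    V : Set
    V = Fin (n G)

    inj : ∀ {u v} → emb W u ≡ emb W v → u ≡ v
    inj = proj₁ (proj₂ (isAW W))

    adjacency : ∀ u v → adj G (emb W u) (emb W v) ≡ pat u v
    adjacency = proj₂ (proj₂ (isAW W))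

    bV-injective : ∀ {k m} {i j : Fin (2 + m)} → bV {k} i ≡ bV j → i ≡ j
    bV-injective refl = refl

    sV≢bV : ∀ {k m} {i : Fin (2 + m)} → sV {k} ≢ bV i
    sV≢bV ()

  emb-Adj⇔ : ∀ u v → Adj G (emb W u) (emb W v) ⇔ T (pat u v)
  emb-Adj⇔ u v = ⇔-trans (mk⇔ (≡-trans (≡-sym (adjacency u v))) (≡-trans (adjacency u v))) (⇔-sym T-≡)

  -- b k is b_k for k ≤ d + 1 (and r beyond)
  index : ℕ → Fin (2 + d W)
  index k = fromℕ< (s≤s (m⊓n≤n k (suc (d W))))

  toℕ-index : ∀ {k} → k ≤ suc (d W) → toℕ (index k) ≡ k
  toℕ-index k≤ = ≡-trans (toℕ-fromℕ< _) (m≤n⇒m⊓n≡m k≤)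

  b : ℕ → V
  b k = bAt W (index k)

  bAt≡b : ∀ i → bAt W i ≡ b (toℕ i)
  bAt≡b i = cong (bAt W) (toℕ-injective (≡-sym (toℕ-index (≤-pred (toℕ<n i)))))

  rTerm≡b : rTerm W ≡ b (suc (d W))
  rTerm≡b = ≡-trans (bAt≡b _) (cong b (toℕ-fromℕ _))

  inner-index : ∀ {k} → 1 ≤ k → k ≤ d W → Inner W (index k)
  inner-index 1≤k k≤d = subst (1 ≤_) (≡-sym i≡k) 1≤k , subst (_≤ d W) (≡-sym i≡k) k≤d
    where i≡k = toℕ-index (m≤n⇒m≤1+n k≤d)

  b-Adj⇔ : ∀ {i j} → i ≤ suc (d W) → j ≤ suc (d W) → Adj G (b i) (b j) ⇔ (suc i ≡ j ⊎ suc j ≡ i)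
  b-Adj⇔ {i} {j} i≤ j≤ = ⇔-trans (emb-Adj⇔ (bV (index i)) (bV (index j)))
    (subst₂ (λ i′ j′ → T (pathAdj (index i) (index j)) ⇔ (suc i′ ≡ j′ ⊎ suc j′ ≡ i′))
            (toℕ-index i≤) (toℕ-index j≤) (T-pathAdj _ _))

  base : Base G (suc (d W))
  base = record
    { s      = shallow W
    ; b      = b
    ; b-step = λ k k<d+1 → Equivalence.from (b-Adj⇔ (<⇒≤ k<d+1) k<d+1) (inj₁ refl)
    ; b-far  = λ i j i+2≤j j≤ bi~bj →
        [ <⇒≢ i+2≤j , (λ j+1≡i → 1+n≰n (≤-trans (≤-reflexive j+1≡i) (≤-trans (m≤n+m i 2) i+2≤j))) ]′
        (Equivalence.to (b-Adj⇔ (≤-trans (m≤n+m i 2) (≤-trans i+2≤j j≤)) j≤) bi~bj)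
    ; b-inj  = λ i j i<j j≤ bi≡bj → <⇒≢ i<j
        (≡-trans (≡-sym (toℕ-index (≤-trans (<⇒≤ i<j) j≤)))
                 (≡-trans (cong toℕ (bV-injective (inj bi≡bj))) (toℕ-index j≤)))
    ; s≁b    = λ k → Equivalence.to (emb-Adj⇔ sV (bV (index k)))
    ; s≢b    = λ k s≡bk → sV≢bV (inj s≡bk)
    }

  center-B-full : ∀ a → isCenter a ≡ true → ∀ k → 1 ≤ k → k ≤ d W → Adj G (emb W a) (b k)
  center-B-full a isC k 1≤k k≤d =
    Equivalence.from (emb-Adj⇔ a (bV (index k)))
      (center-sees-inner a isC (index k) (proj₁ (inner-index 1≤k k≤d)) (proj₂ (inner-index 1≤k k≤d)))

  s~center : ∀ a → isCenter a ≡ true → Adj G (shallow W) (emb W a)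
  s~center a isC = Equivalence.from (emb-Adj⇔ sV a) (center-sees-shallow a isC)

  skeleton : 3 ≤ d W → Skeleton G
  skeleton 3≤d = record
    { m    = d W
    ; 3≤m  = 3≤d
    ; base = base
    ; cL   = emb W (leftCenter (kind W))
    ; cR   = emb W (rightCenter (kind W))
    ; s~cL = s~center _ (leftCenter-isCenter (kind W))
    ; s~cR = s~center _ (rightCenter-isCenter (kind W))
    ; cL≁l = λ cL~l → leftCenter-misses-l (kind W) (Equivalence.to (emb-Adj⇔ _ (bV zero)) cL~l)
    ; cR≁r = λ cR~r → rightCenter-misses-r (kind W) (index (suc (d W))) (toℕ-index ≤-refl)
                        (Equivalence.to (emb-Adj⇔ _ (bV _)) cR~r)
    ; cL~B = center-B-full _ (leftCenter-isCenter (kind W))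
    ; cR~B = center-B-full _ (rightCenter-isCenter (kind W))
    }

-- A ‡-AW with d = 2 contains the asteroidal triple {s, l, r}: s reaches l via c₁ and r via c₂.
AW-d≥3 : ∀ {G} → Prereduced G → (W : AW G) → 3 ≤ d W
AW-d≥3 pre record { kind = dagger ; isAW = 3≤d , _ } = 3≤d
AW-d≥3 pre W@record { kind = ddagger ; isAW = 2≤d , _ } with m≤n⇒m<n∨m≡n 2≤d
... | inj₁ 3≤d = 3≤d
... | inj₂ refl =
  ⊥-elim (no-shallow-asteroid {0} {3} (≤ᵇ⇒≤ _ _ _) (≤ᵇ⇒≤ _ _ _) ≤-refl
            0 (s~center c1V refl) z≤n (≤ᵇ⇒≤ _ _ _)
              (Equivalence.from (emb-Adj⇔ c1V (bV zero)) _) (Equivalence.to (emb-Adj⇔ c1V (bV _)))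
            3 (s~center c2V refl) (≤ᵇ⇒≤ _ _ _) ≤-refl
              (Equivalence.from (emb-Adj⇔ c2V (bV _)) _) (Equivalence.to (emb-Adj⇔ c2V (bV zero))))
  where
  open FromAW W
  open ShallowAsteroid pre base

replaceS-isAW : ∀ {G} (W : AW G) {x} → Adj G x (shallow W) →
                (∀ a → adj G x (replaceS W x a) ≡ pat sV a) → IsAW G (kind W) (d W) (replaceS W x)
replaceS-isAW {G} W {x} x~s agree = proj₁ (isAW W) , r-inj , r-pattern
  where
  open Basics G

  r = replaceS W x
  inj = proj₁ (proj₂ (isAW W))
  adjacency = proj₂ (proj₂ (isAW W))

  view : ∀ a → a ≡ sV ⊎ r a ≡ emb W a
  view sV     = inj₁ refl
  view cV     = inj₂ refl
  view c1V    = inj₂ refl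
  view c2V    = inj₂ refl
  view (bV _) = inj₂ refl

  pat-sym-s : ∀ a → pat a sV ≡ pat sV a
  pat-sym-s a = ≡-trans (≡-sym (adjacency a sV)) (≡-trans (sym G _ _) (adjacency sV a))

  x≢other : ∀ {a} → r a ≡ emb W a → x ≢ emb W a
  x≢other {a} ra≡ x≡a = true≢false (begin
    true                     ≡⟨ ≡-sym (subst (λ y → adj G y (emb W sV) ≡ true) x≡a x~s) ⟩
    adj G (emb W a) (shallow W) ≡⟨ adjacency a sV ⟩
    pat a sV                 ≡⟨ pat-sym-s a ⟩
    pat sV a                 ≡⟨ ≡-sym (agree a) ⟩
    adj G x (r a)            ≡⟨ cong (adj G x) (≡-trans ra≡ (≡-sym x≡a)) ⟩
    adj G x x                ≡⟨ irrefl G x ⟩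
    false                    ∎)
    where
    open ≡-Reasoning
    true≢false : true ≢ false
    true≢false ()

  r-inj : ∀ {u v} → r u ≡ r v → u ≡ v
  r-inj {u} {v} ru≡rv with view u | view v
  ... | inj₁ refl | inj₁ refl = refl
  ... | inj₁ refl | inj₂ rv≡ = ⊥-elim (x≢other rv≡ (≡-trans ru≡rv rv≡))
  ... | inj₂ ru≡ | inj₁ refl = ⊥-elim (x≢other ru≡ (≡-trans (≡-sym ru≡rv) ru≡))
  ... | inj₂ ru≡ | inj₂ rv≡ = inj (≡-trans (≡-sym ru≡) (≡-trans ru≡rv rv≡))

  r-pattern : ∀ u v → adj G (r u) (r v) ≡ pat u v
  r-pattern u v with view u | view v
  ... | inj₁ refl | _         = agree v
  ... | inj₂ _    | inj₁ refl = ≡-trans (sym G (r u) x) (≡-trans (agree u) (≡-sym (pat-sym-s u)))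
  ... | inj₂ ru≡  | inj₂ rv≡  = ≡-trans (cong₂ (adj G) ru≡ rv≡) (adjacency u v)

module Lemma5p2 {G : Graph} (pre : Prereduced G) (W : AW G) {x : Fin (n G)} (x~s : Adj G x (shallow W)) where

  open Basics G
  open FromAW W hiding (b; base)
  open SkeletonLemmas pre (skeleton (AW-d≥3 pre W))

  adjacent-to-centers : ∀ a → isCenter a ≡ true → emb W a ≢ x → Adj G x (emb W a)
  adjacent-to-centers a isC a≢x = adjacent-to-B-full x~s (s~center a isC) (center-B-full a isC) (≢-sym a≢x)

  B-full-adjacent-to-N[s] : (∀ i → Inner W i → Adj G x (bAt W i)) →
                            ∀ y → Adj G (shallow W) y → y ≢ x → Adj G x y
  B-full-adjacent-to-N[s] x~B y s~y y≢x =
    Adj-sym (adjacent-to-B-full (Adj-sym s~y) (Adj-sym x~s)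
                                (λ k 1≤k k≤d → x~B (index k) (inner-index 1≤k k≤d)) y≢x)

  B-partial⇒sub-AW :
    Σ (Fin (2 + d W)) (λ i → Inner W i × Adj G x (bAt W i)) →
    Σ (Fin (2 + d W)) (λ j → Inner W j × ¬ Adj G x (bAt W j)) →
    Σ (AW G) λ W′ → shallow W′ ≡ shallow W × IsCenterOf W′ x × Σ ℕ λ p → Σ ℕ λ q →
      1 ≤ p × p ≤ q × q ≤ d W × ¬ (p ≡ 1 × q ≡ d W) ×
      (∀ v → InBase W′ v ⇔ Σ (Fin (2 + d W)) (λ i → p ≤ toℕ i × toℕ i ≤ q × bAt W i ≡ v))
  B-partial⇒sub-AW (i , (1≤i , i≤d) , x~bi) (j , (1≤j , j≤d) , x≁bj)
    with partial-neighbour x~s 1≤i i≤d (subst (Adj G x) (bAt≡b i) x~bi)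
                                1≤j j≤d (subst (λ v → ¬ Adj G x v) (bAt≡b j) x≁bj)
  ... | p , q , 1≤p , p≤q , q≤d , proper , W′ , W′-s , W′-x , InBase-W′ =
    W′ , W′-s , W′-x , p , q , 1≤p , p≤q , q≤d , proper ,
    λ v → ⇔-trans (InBase-W′ v) (⇔-sym (Σ-Fin⇔Σ-ℕ (bAt W) b bAt≡b (m≤n⇒m≤1+n q≤d)))

  B-empty⇒replaces-s : (∀ i → Inner W i → ¬ Adj G x (bAt W i)) →
                       ¬ Adj G x (lTerm W) × ¬ Adj G x (rTerm W) × IsAW G (kind W) (d W) (replaceS W x)
  B-empty⇒replaces-s x≁B =
    x≁l , subst (λ v → ¬ Adj G x v) (≡-sym rTerm≡b) x≁r , replaceS-isAW W x~s agree
    where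
    x≁inner : ∀ k → 1 ≤ k → k ≤ d W → ¬ Adj G x (b k)
    x≁inner k 1≤k k≤d = x≁B (index k) (inner-index 1≤k k≤d)

    x≁l = proj₁ (misses-ends x~s x≁inner)
    x≁r = proj₂ (misses-ends x~s x≁inner)

    x≁b : ∀ k → k ≤ suc (d W) → ¬ Adj G x (b k)
    x≁b zero    _ = x≁l
    x≁b (suc k) k<d+1 with m≤n⇒m<n∨m≡n k<d+1
    ... | inj₁ k<d  = x≁inner (suc k) (s≤s z≤n) (≤-pred k<d)
    ... | inj₂ refl = x≁r

    center≢x : ∀ a → isCenter a ≡ true → emb W a ≢ x
    center≢x a isC = ≢-by (center-B-full a isC 1 ≤-refl 1≤d) (x≁inner 1 ≤-refl 1≤d)
      where 1≤d = ≤-trans (s≤s z≤n) (AW-d≥3 pre W)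

    agree : ∀ a → adj G x (replaceS W x a) ≡ pat sV a
    agree sV     = irrefl G x
    agree cV     = adjacent-to-centers cV refl (center≢x cV refl)
    agree c1V    = adjacent-to-centers c1V refl (center≢x c1V refl)
    agree c2V    = adjacent-to-centers c2V refl (center≢x c2V refl)
    agree (bV i) =
      ¬Adj⇒adj≡false (subst (λ v → ¬ Adj G x v) (≡-sym (bAt≡b i)) (x≁b (toℕ i) (≤-pred (toℕ<n i))))

lemma5p2 : (G : Graph) → Prereduced G → (W : AW G) → (x : Fin (n G)) →
    Adj G x (shallow W) →
    (∀ (a : Lab (kind W) (d W)) → isCenter a ≡ true → emb W a ≢ x →
        Adj G x (emb W a))
    × ((∀ i → Inner W i → Adj G x (bAt W i)) →
        ∀ y → Adj G (shallow W) y → y ≢ x → Adj G x y)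
    × (Σ (Fin (2 + d W)) (λ i → Inner W i × Adj G x (bAt W i)) →
       Σ (Fin (2 + d W)) (λ j → Inner W j × ¬ Adj G x (bAt W j)) →
       Σ (AW G) λ W' →
         shallow W' ≡ shallow W × IsCenterOf W' x ×
         Σ ℕ λ p → Σ ℕ λ q →
           1 ≤ p × p ≤ q × q ≤ d W × ¬ (p ≡ 1 × q ≡ d W) ×
           (∀ v → InBase W' v ⇔
              Σ (Fin (2 + d W)) (λ i → p ≤ toℕ i × toℕ i ≤ q × bAt W i ≡ v)))
    × ((∀ i → Inner W i → ¬ Adj G x (bAt W i)) →
        ¬ Adj G x (lTerm W) × ¬ Adj G x (rTerm W) ×
        IsAW G (kind W) (d W) (replaceS W x))
lemma5p2 G pre W x x~s =
  adjacent-to-centers , B-full-adjacent-to-N[s] , B-partial⇒sub-AW , B-empty⇒replaces-s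
  where open Lemma5p2 pre W x~s
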